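{- Let $\mathcal{N}\in\mathbb{N}$ be such that for all integers $m>\mathcal{N}$ and all positive integers $k\le 8m^3$, when $m$ robots independently choose one of $k$ destinations uniformly at random, the probability that some destination receives more than $\frac{m}{k}(1+k^{3/4})$ robots is at most $\frac{1}{2k}$ (such an $\mathcal{N}$ exists). Let $C$ be a configuration of $n$ robots occupying $u\ge1$ distinct points $P_1,\dots,P_u$, each of multiplicity at most $m$, and let $x$ be a positive integer. Let $k=\max(16x^4,u^3,8\mathcal{N}^3)$ and suppose there are pairwise disjoint sets $D_1,\dots,D_u$ of $k$ points each such that every robot at $P_i$ moves to a point of $D_i$ chosen uniformly at random, independently of all other robots. Then, with probability at least $\frac12$, the maximum multiplicity of the resulting configuration is $1$ or at most $m/x$. -}

module Defs where

open import Data.Nat using (ℕ; zero; suc; _+_; _*_; _∸_; _^_; _<_; _≤_; _⊔_; _≡ᵇ_; _<ᵇ_; _≤ᵇ_)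
open import Data.Bool using (Bool; true; false; _∧_; _∨_; if_then_else_)
open import Data.Fin using (Fin; toℕ)
open import Data.List using (List; []; _∷_; map; concatMap; foldr; length; allFin)
open import Data.Bool.ListAction using (any)
open import Data.Product using (_×_; ∃)
import Data.Vec.Functional as VF
open import Relation.Binary.PropositionalEquality using (_≡_)

_=ᶠ_ : ∀ {n} → Fin n → Fin n → Bool
a =ᶠ b = toℕ a ≡ᵇ toℕ b

countB : ∀ {A : Set} → (A → Bool) → List A → ℕ
countB p [] = 0
countB p (a ∷ as) = if p a then suc (countB p as) else countB p as

-- the list of all functions Fin n → Fin k (the uniform sample space of
-- n independent uniform choices among k destinations; it has k ^ n elements)
funs : (n k : ℕ) → List (Fin n → Fin k)
funs zero k = (λ ()) ∷ []
funs (suc n) k = concatMap (λ f → map (λ d → d VF.∷ f) (allFin k)) (funs n k)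

load : ∀ {n k} → (Fin n → Fin k) → Fin k → ℕ
load {n} ω d = countB (λ j → ω j =ᶠ d) (allFin n)

-- exact integer encoding of  c > (m/k)(1 + k^{3/4})  for k ≥ 1:
-- c·k − m > m·k^{3/4}  ⇔  c·k > m  and  (c·k − m)^4 > m^4·k^3
exceedsᵇ : (m k c : ℕ) → Bool
exceedsᵇ m k c = (m <ᵇ c * k) ∧ ((m ^ 4 * k ^ 3) <ᵇ ((c * k ∸ m) ^ 4))

overloadedᵇ : ∀ {m k} → (Fin m → Fin k) → Bool
overloadedᵇ {m} {k} ω = any (λ d → exceedsᵇ m k (load ω d)) (allFin k)

-- The property assumed of 𝒩 (probability bound via counting:
-- #bad / k^m ≤ 1/(2k)  ⇔  2k · #bad ≤ k^m)
GoodN : ℕ → Set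
GoodN N = ∀ (m k : ℕ) → N < m → 1 ≤ k → k ≤ 8 * m ^ 3 →
  2 * k * countB overloadedᵇ (funs m k) ≤ k ^ m

-- A configuration of n robots on u distinct occupied points P_1..P_u,
-- represented by pos : Fin n → Fin u (robot j sits at P_{pos j}).
-- Multiplicity of point P_i:
mult : ∀ {n u} → (Fin n → Fin u) → Fin u → ℕ
mult {n} pos i = countB (λ j → pos j =ᶠ i) (allFin n)

-- After the move, robot j sits at the point ω j of D_{pos j}; since the D_i are
-- pairwise disjoint, the resulting points are identified with pairs (i , d).
newMult : ∀ {n u k} → (Fin n → Fin u) → (Fin n → Fin k) → Fin u → Fin k → ℕ
newMult {n} pos ω i d = countB (λ j → (pos j =ᶠ i) ∧ (ω j =ᶠ d)) (allFin n)

maxNewMult : ∀ {n u k} → (Fin n → Fin u) → (Fin n → Fin k) → ℕ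
maxNewMult {u = u} {k} pos ω =
  foldr _⊔_ 0 (concatMap (λ i → map (λ d → newMult pos ω i d) (allFin k)) (allFin u))

successᵇ : ∀ {n u k} → (m x : ℕ) → (Fin n → Fin u) → (Fin n → Fin k) → Bool
successᵇ m x pos ω = (maxNewMult pos ω ≡ᵇ 1) ∨ (maxNewMult pos ω * x ≤ᵇ m)

kOf : (x u N : ℕ) → ℕ
kOf x u N = (16 * x ^ 4 ⊔ u ^ 3) ⊔ 8 * N ^ 3

module Submission where

-- The robots at P_i land in D_i, disjoint from the other D_j, so the final
-- multiplicities are the bin loads of u independent experiments throwing
-- m_i ≤ m balls into k bins, and probabilities are counts over all k^n outcomes.
-- Experiment i is bad if, when m_i > 𝒩 and k ≤ 8m_i³, some bin is overloaded
-- (probability ≤ 1/(2k) ≤ 1/(2u) by the choice of 𝒩), and otherwise if two balls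
-- share a bin (probability ≤ m_i²/(2k) ≤ 1/(2u) by the birthday bound, since now
-- k ≥ 8m_i³, directly or via k ≥ 8𝒩³, which with k ≥ u³ gives u m_i² ≤ k).
-- A bin that is not overloaded holds at most (m_i/k)(1 + k^{3/4}) ≤ m/x balls
-- because k ≥ 16x⁴, so when no experiment is bad every multiplicity is 1 or at
-- most m/x; by the union bound this happens with probability at least 1/2.

open import Defs
open import Data.Nat using (ℕ; zero; suc; _+_; _*_; _∸_; _^_; _<_; _≤_; _⊔_; _≡ᵇ_; _<ᵇ_; _≤ᵇ_; z≤n; s≤s; NonZero; >-nonZero)
open import Data.Nat.Properties
open import Data.Nat.ListAction as List using ()
open import Data.Nat.ListAction.Properties as List using ()
open import Data.Nat.Tactic.RingSolver using (solve-∀)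
open import Data.Nat.Solver using (module +-*-Solver)
open import Data.Bool using (Bool; true; false; T; not; _∧_; _∨_)
open import Data.Empty using (⊥-elim)
open import Data.Fin using (Fin; toℕ; zero; suc)
open import Data.Fin.Properties using (toℕ-injective)
open import Data.List using (List; []; _∷_; _++_; map; concatMap; allFin; tabulate)
open import Data.List.Properties using (map-++; map-tabulate; map-∘; map-cong; foldr-preservesᵇ)
open import Data.List.Relation.Unary.All.Properties using (map⁺; concat⁺; tabulate⁺)
open import Data.Bool.ListAction using (any; or)
open import Data.List.Relation.Unary.Any.Properties using (any⁺)
open import Data.List.Membership.Propositional using (lose)
open import Data.List.Membership.Propositional.Properties using (∈-allFin)
open import Data.Product using (∃)
open import Data.Sum using (_⊎_; inj₁; inj₂)
import Data.Vec.Functional as Vec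
open import Function using (_∘_; id)
open import Relation.Binary.PropositionalEquality
open import Relation.Nullary using (¬_; yes; no)
open import Algebra.Properties.Semiring.Sum +-*-semiring

⟦_⟧ : Bool → ℕ
⟦ true ⟧ = 1
⟦ false ⟧ = 0

⟦b⟧+⟦not-b⟧≡1 : ∀ b → ⟦ b ⟧ + ⟦ not b ⟧ ≡ 1
⟦b⟧+⟦not-b⟧≡1 true = refl
⟦b⟧+⟦not-b⟧≡1 false = refl

¬T⇒⟦⟧≡0 : ∀ {b} → ¬ T b → ⟦ b ⟧ ≡ 0
¬T⇒⟦⟧≡0 {true} ¬b = ⊥-elim (¬b _)
¬T⇒⟦⟧≡0 {false} ¬b = refl

⟦⟧≤1 : ∀ b → ⟦ b ⟧ ≤ 1
⟦⟧≤1 true = s≤s z≤n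
⟦⟧≤1 false = z≤n

=ᶠ⇒≡ : ∀ {k} {a d : Fin k} → T (a =ᶠ d) → a ≡ d
=ᶠ⇒≡ {a = a} {d} t = toℕ-injective (≡ᵇ⇒≡ (toℕ a) (toℕ d) t)

sum-mono-≤ : ∀ {n} {f g : Fin n → ℕ} → (∀ i → f i ≤ g i) → sum f ≤ sum g
sum-mono-≤ {zero} f≤g = z≤n
sum-mono-≤ {suc n} f≤g = +-mono-≤ (f≤g zero) (sum-mono-≤ (f≤g ∘ suc))

sum-const : ∀ n c → ∑[ i < n ] c ≡ n * c
sum-const zero c = refl
sum-const (suc n) c = cong (c +_) (sum-const n c)

sum-δ : ∀ {k} (a : Fin k) → ∑[ d < k ] ⟦ a =ᶠ d ⟧ ≡ 1
sum-δ {suc k} zero = cong suc (sum-replicate-zero k)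
sum-δ (suc a) = sum-δ a

count : ∀ {n} → (Fin n → Bool) → ℕ
count p = ∑[ i < _ ] ⟦ p i ⟧

count-true : ∀ n → count {n} (λ _ → true) ≡ n
count-true n = trans (sum-const n 1) (*-identityʳ n)

count+count-not : ∀ {n} (p : Fin n → Bool) → count p + count (not ∘ p) ≡ n
count+count-not {n} p = begin
  count p + count (not ∘ p)           ≡⟨ ∑-distrib-+ (⟦_⟧ ∘ p) (⟦_⟧ ∘ not ∘ p) ⟨
  ∑[ i < n ] (⟦ p i ⟧ + ⟦ not (p i) ⟧) ≡⟨ sum-cong-≗ (⟦b⟧+⟦not-b⟧≡1 ∘ p) ⟩
  ∑[ i < n ] 1                        ≡⟨ count-true n ⟩
  n                                   ∎
  where open ≡-Reasoning

⟦⟧≤count : ∀ {n} b (p : Fin n → Bool) → ((∀ i → ¬ T (p i)) → ¬ T b) → ⟦ b ⟧ ≤ count p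
⟦⟧≤count {zero} false p _ = z≤n
⟦⟧≤count {zero} true p none⇒¬b = ⊥-elim (none⇒¬b (λ ()) _)
⟦⟧≤count {suc n} b p none⇒¬b with p zero in eq
... | true = ≤-trans (⟦⟧≤1 b) (m≤m+n 1 _)
... | false = ⟦⟧≤count b (p ∘ suc) λ none → none⇒¬b λ
  { zero → subst T eq
  ; (suc i) → none i }

countB≡sum : ∀ {A : Set} (p : A → Bool) xs → countB p xs ≡ List.sum (map (⟦_⟧ ∘ p) xs)
countB≡sum p [] = refl
countB≡sum p (x ∷ xs) with p x
... | true = cong suc (countB≡sum p xs)
... | false = countB≡sum p xs

sum-map-allFin : ∀ {k} (f : Fin k → ℕ) → List.sum (map f (allFin k)) ≡ sum f
sum-map-allFin f = trans (cong List.sum (map-tabulate id f)) (sum-tabulate f)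
  where
  sum-tabulate : ∀ {k} (f : Fin k → ℕ) → List.sum (tabulate f) ≡ sum f
  sum-tabulate {zero} f = refl
  sum-tabulate {suc k} f = cong (f zero +_) (sum-tabulate (f ∘ suc))

countB-allFin : ∀ {n} (p : Fin n → Bool) → countB p (allFin n) ≡ count p
countB-allFin p = trans (countB≡sum p (allFin _)) (sum-map-allFin (⟦_⟧ ∘ p))

-- Sums over the sample space

sumFuns : ∀ n k → ((Fin n → Fin k) → ℕ) → ℕ
sumFuns zero k F = F (λ ())
sumFuns (suc n) k F = sumFuns n k (λ ω → ∑[ d < k ] F (d Vec.∷ ω))

sum-map-funs : ∀ n k (F : (Fin n → Fin k) → ℕ) → List.sum (map F (funs n k)) ≡ sumFuns n k F
sum-map-funs zero k F = +-identityʳ (F (λ ()))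
sum-map-funs (suc n) k F = trans (extend (funs n k)) (sum-map-funs n k _)
  where
  extend : ∀ ωs → List.sum (map F (concatMap (λ ω → map (Vec._∷ ω) (allFin k)) ωs))
                ≡ List.sum (map (λ ω → ∑[ d < k ] F (d Vec.∷ ω)) ωs)
  extend [] = refl
  extend (ω ∷ ωs) = begin
    List.sum (map F (map (Vec._∷ ω) (allFin k) ++ rest))
      ≡⟨ cong List.sum (map-++ F (map (Vec._∷ ω) (allFin k)) rest) ⟩
    List.sum (map F (map (Vec._∷ ω) (allFin k)) ++ map F rest)
      ≡⟨ List.sum-++ (map F (map (Vec._∷ ω) (allFin k))) (map F rest) ⟩
    List.sum (map F (map (Vec._∷ ω) (allFin k))) + List.sum (map F rest)
      ≡⟨ cong₂ _+_ (trans (cong List.sum (sym (map-∘ (allFin k)))) (sum-map-allFin (F ∘ (Vec._∷ ω)))) (extend ωs) ⟩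
    ∑[ d < k ] F (d Vec.∷ ω) + List.sum (map (λ ω → ∑[ d < k ] F (d Vec.∷ ω)) ωs) ∎
    where
    open ≡-Reasoning
    rest = concatMap (λ ω → map (Vec._∷ ω) (allFin k)) ωs

countB-funs : ∀ n k (p : (Fin n → Fin k) → Bool) → countB p (funs n k) ≡ sumFuns n k (⟦_⟧ ∘ p)
countB-funs n k p = trans (countB≡sum p (funs n k)) (sum-map-funs n k (⟦_⟧ ∘ p))

sumFuns-cong : ∀ n {k} {F G : (Fin n → Fin k) → ℕ} → (∀ ω → F ω ≡ G ω) → sumFuns n k F ≡ sumFuns n k G
sumFuns-cong zero F≗G = F≗G _
sumFuns-cong (suc n) F≗G = sumFuns-cong n λ ω → sum-cong-≗ λ d → F≗G (d Vec.∷ ω)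

sumFuns-mono-≤ : ∀ n {k} {F G : (Fin n → Fin k) → ℕ} → (∀ ω → F ω ≤ G ω) → sumFuns n k F ≤ sumFuns n k G
sumFuns-mono-≤ zero F≤G = F≤G _
sumFuns-mono-≤ (suc n) F≤G = sumFuns-mono-≤ n λ ω → sum-mono-≤ λ d → F≤G (d Vec.∷ ω)

sumFuns-distrib-+ : ∀ n {k} (F G : (Fin n → Fin k) → ℕ) →
  sumFuns n k (λ ω → F ω + G ω) ≡ sumFuns n k F + sumFuns n k G
sumFuns-distrib-+ zero F G = refl
sumFuns-distrib-+ (suc n) F G = trans
  (sumFuns-cong n λ ω → ∑-distrib-+ (F ∘ (Vec._∷ ω)) (G ∘ (Vec._∷ ω)))
  (sumFuns-distrib-+ n _ _)

*-distribˡ-sumFuns : ∀ n {k} c (F : (Fin n → Fin k) → ℕ) → c * sumFuns n k F ≡ sumFuns n k (λ ω → c * F ω)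
*-distribˡ-sumFuns zero c F = refl
*-distribˡ-sumFuns (suc n) c F = trans
  (*-distribˡ-sumFuns n c _)
  (sumFuns-cong n λ ω → *-distribˡ-sum c (F ∘ (Vec._∷ ω)))

sumFuns-const : ∀ n {k} c → sumFuns n k (λ _ → c) ≡ c * k ^ n
sumFuns-const zero c = sym (*-identityʳ c)
sumFuns-const (suc n) {k} c = begin
  sumFuns n k (λ _ → ∑[ d < k ] c) ≡⟨ sumFuns-cong n (λ _ → sum-const k c) ⟩
  sumFuns n k (λ _ → k * c)        ≡⟨ sumFuns-const n (k * c) ⟩
  k * c * k ^ n                    ≡⟨ cong (_* k ^ n) (*-comm k c) ⟩
  c * k * k ^ n                    ≡⟨ *-assoc c k (k ^ n) ⟩
  c * k ^ suc n                    ∎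
  where open ≡-Reasoning

sumFuns-comm : ∀ n {k u} (F : Fin u → (Fin n → Fin k) → ℕ) →
  sumFuns n k (λ ω → ∑[ i < u ] F i ω) ≡ ∑[ i < u ] sumFuns n k (F i)
sumFuns-comm zero F = refl
sumFuns-comm (suc n) {k} F = trans
  (sumFuns-cong n λ ω → ∑-comm λ d i → F i (d Vec.∷ ω))
  (sumFuns-comm n λ i ω → ∑[ d < k ] F i (d Vec.∷ ω))

loadOn : ∀ {n k} → (Fin n → Bool) → (Fin n → Fin k) → Fin k → ℕ
loadOn b ω d = count (λ j → b j ∧ (ω j =ᶠ d))

load≡loadOn : ∀ {n k} (ω : Fin n → Fin k) d → load ω d ≡ loadOn (λ _ → true) ω d
load≡loadOn ω d = countB-allFin (λ j → ω j =ᶠ d)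

newMult≡loadOn : ∀ {n u k} (pos : Fin n → Fin u) (ω : Fin n → Fin k) i d →
  newMult pos ω i d ≡ loadOn (λ j → pos j =ᶠ i) ω d
newMult≡loadOn pos ω i d = countB-allFin (λ j → (pos j =ᶠ i) ∧ (ω j =ᶠ d))

_⊕_ : ∀ {k} → (Fin k → ℕ) → (Fin k → ℕ) → Fin k → ℕ
(l ⊕ l′) d = l d + l′ d

δ : ∀ {k} → Fin k → Fin k → ℕ
δ a d = ⟦ a =ᶠ d ⟧

module Marginal {k : ℕ} (F : (Fin k → ℕ) → ℕ) (F-cong : ∀ {l l′} → (∀ d → l d ≡ l′ d) → F l ≡ F l′) where

  sumFuns-peel : ∀ {n} (b : Fin n → Bool) c →
    sumFuns (suc n) k (λ ω → F (c ⊕ loadOn (true Vec.∷ b) ω))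
      ≡ ∑[ a < k ] sumFuns n k (λ ω → F ((c ⊕ δ a) ⊕ loadOn b ω))
  sumFuns-peel {n} b c = trans
    (sumFuns-cong n λ ω → sum-cong-≗ λ a → F-cong λ d → sym (+-assoc (c d) (δ a d) _))
    (sumFuns-comm n λ a ω → F ((c ⊕ δ a) ⊕ loadOn b ω))

  -- The offset c, the load of the robots already placed, makes the induction on n go through.
  sumFuns-marginal : ∀ {n} (b : Fin n → Bool) c →
    sumFuns n k (λ ω → F (c ⊕ loadOn b ω))
      ≡ k ^ count (not ∘ b) * sumFuns (count b) k (λ ω → F (c ⊕ loadOn (λ _ → true) ω))
  sumFuns-marginal {zero} b c = sym (+-identityʳ _)
  sumFuns-marginal {suc n} b c = marginal-∷ (b zero) (b ∘ suc) c
    where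
    open ≡-Reasoning
    marginal-∷ : ∀ b₀ (b : Fin n → Bool) c →
      sumFuns (suc n) k (λ ω → F (c ⊕ loadOn (b₀ Vec.∷ b) ω))
        ≡ k ^ count (not ∘ (b₀ Vec.∷ b)) * sumFuns (count (b₀ Vec.∷ b)) k (λ ω → F (c ⊕ loadOn (λ _ → true) ω))
    marginal-∷ true b c = begin
      sumFuns (suc n) k (λ ω → F (c ⊕ loadOn (true Vec.∷ b) ω))
        ≡⟨ sumFuns-peel b c ⟩
      ∑[ a < k ] sumFuns n k (λ ω → F ((c ⊕ δ a) ⊕ loadOn b ω))
        ≡⟨ sum-cong-≗ (λ a → sumFuns-marginal b (c ⊕ δ a)) ⟩
      ∑[ a < k ] (k ^ f * sumFuns t k (λ ω → F ((c ⊕ δ a) ⊕ loadOn (λ _ → true) ω)))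
        ≡⟨ *-distribˡ-sum (k ^ f) (λ a → sumFuns t k (λ ω → F ((c ⊕ δ a) ⊕ loadOn (λ _ → true) ω))) ⟨
      k ^ f * ∑[ a < k ] sumFuns t k (λ ω → F ((c ⊕ δ a) ⊕ loadOn (λ _ → true) ω))
        ≡⟨ cong (k ^ f *_) (sumFuns-peel {n = t} (λ _ → true) c) ⟨
      k ^ f * sumFuns (suc t) k (λ ω → F (c ⊕ loadOn (λ _ → true) ω)) ∎
      where
      f = count (not ∘ b)
      t = count b
    marginal-∷ false b c = begin
      sumFuns n k (λ ω → ∑[ a < k ] F (c ⊕ loadOn b ω))
        ≡⟨ sumFuns-cong n (λ ω → sum-const k _) ⟩
      sumFuns n k (λ ω → k * F (c ⊕ loadOn b ω))
        ≡⟨ *-distribˡ-sumFuns n k _ ⟨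
      k * sumFuns n k (λ ω → F (c ⊕ loadOn b ω))
        ≡⟨ cong (k *_) (sumFuns-marginal b c) ⟩
      k * (k ^ count (not ∘ b) * _)
        ≡⟨ *-assoc k _ _ ⟨
      k ^ suc (count (not ∘ b)) * _ ∎

sum-loadOn : ∀ {n k} (b : Fin n → Bool) (ω : Fin n → Fin k) → ∑[ d < k ] loadOn b ω d ≡ count b
sum-loadOn {n} {k} b ω = begin
  ∑[ d < k ] ∑[ j < n ] ⟦ b j ∧ (ω j =ᶠ d) ⟧ ≡⟨ ∑-comm (λ d j → ⟦ b j ∧ (ω j =ᶠ d) ⟧) ⟩
  ∑[ j < n ] ∑[ d < k ] ⟦ b j ∧ (ω j =ᶠ d) ⟧ ≡⟨ sum-cong-≗ (λ j → sum-δ-∧ (b j) (ω j)) ⟩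
  count b                                   ∎
  where
  open ≡-Reasoning
  sum-δ-∧ : ∀ b (a : Fin k) → ∑[ d < k ] ⟦ b ∧ (a =ᶠ d) ⟧ ≡ ⟦ b ⟧
  sum-δ-∧ true a = sum-δ a
  sum-δ-∧ false a = sum-replicate-zero k

-- The birthday bound

any-allFin-cong : ∀ {k} {p q : Fin k → Bool} → (∀ d → p d ≡ q d) → any p (allFin k) ≡ any q (allFin k)
any-allFin-cong {k} p≗q = cong or (map-cong p≗q (allFin k))

¬any-allFin : ∀ {k} (p : Fin k → Bool) → ¬ T (any p (allFin k)) → ∀ d → ¬ T (p d)
¬any-allFin p ¬any d pd = ¬any (any⁺ p (lose (∈-allFin d) pd))

¬any-false : ∀ {A : Set} (xs : List A) → ¬ T (any (λ _ → false) xs)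
¬any-false [] ()
¬any-false (x ∷ xs) = ¬any-false xs

collides : ∀ {k} → (Fin k → ℕ) → Bool
collides l = any (λ d → 1 <ᵇ l d) (allFin _)

collides-cong : ∀ {k} {l l′ : Fin k → ℕ} → (∀ d → l d ≡ l′ d) → collides l ≡ collides l′
collides-cong l≗l′ = any-allFin-cong (cong (1 <ᵇ_) ∘ l≗l′)

¬collides⇒≤1 : ∀ {k} (l : Fin k → ℕ) → ¬ T (collides l) → ∀ d → l d ≤ 1
¬collides⇒≤1 l ¬coll d = ≮⇒≥ (¬any-allFin (λ d → 1 <ᵇ l d) ¬coll d ∘ <⇒<ᵇ)

collides-δ⊕ : ∀ {k} (a : Fin k) (l : Fin k → ℕ) → ⟦ collides (δ a ⊕ l) ⟧ ≤ ⟦ collides l ⟧ + l a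
collides-δ⊕ a l with l a in la
... | suc v = ≤-trans (⟦⟧≤1 _) (≤-trans (s≤s z≤n) (m≤n+m (suc v) _))
... | zero = ≤-reflexive (trans (cong ⟦_⟧ (any-allFin-cong unchanged)) (sym (+-identityʳ _)))
  where
  unchanged : ∀ d → (1 <ᵇ δ a d + l d) ≡ (1 <ᵇ l d)
  unchanged d with a =ᶠ d in a=d
  ... | false = refl
  ... | true = trans (cong (λ v → 1 <ᵇ suc v) ld≡0) (cong (1 <ᵇ_) (sym ld≡0))
    where
    ld≡0 : l d ≡ 0
    ld≡0 = trans (cong l (sym (=ᶠ⇒≡ (subst T (sym a=d) _)))) la

module _ {k : ℕ} where

  collisions : ℕ → ℕ
  collisions M = sumFuns M k (λ ω → ⟦ collides (loadOn (λ _ → true) ω) ⟧)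

  collisions-suc : ∀ M → collisions (suc M) ≤ k * collisions M + M * k ^ M
  collisions-suc M = begin
    sumFuns M k (λ ω → ∑[ a < k ] ⟦ collides (δ a ⊕ L ω) ⟧)
      ≤⟨ sumFuns-mono-≤ M (λ ω → sum-mono-≤ λ a → collides-δ⊕ a (L ω)) ⟩
    sumFuns M k (λ ω → ∑[ a < k ] (⟦ collides (L ω) ⟧ + L ω a))
      ≡⟨ sumFuns-cong M (λ ω → trans (∑-distrib-+ _ (L ω))
           (cong₂ _+_ (sum-const k _) (trans (sum-loadOn _ ω) (count-true M)))) ⟩
    sumFuns M k (λ ω → k * ⟦ collides (L ω) ⟧ + M)
      ≡⟨ sumFuns-distrib-+ M _ _ ⟩
    sumFuns M k (λ ω → k * ⟦ collides (L ω) ⟧) + sumFuns M k (λ _ → M)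
      ≡⟨ cong₂ _+_ (sym (*-distribˡ-sumFuns M k _)) (sumFuns-const M M) ⟩
    k * collisions M + M * k ^ M ∎
    where
    open ≤-Reasoning
    L : (Fin M → Fin k) → Fin k → ℕ
    L = loadOn (λ _ → true)

  birthday-bound : ∀ M → 2 * k * collisions M ≤ M * M * k ^ M
  birthday-bound zero =
    ≤-reflexive (trans (cong (2 * k *_) (¬T⇒⟦⟧≡0 (¬any-false (allFin k)))) (*-zeroʳ (2 * k)))
  birthday-bound (suc M) = begin
    2 * k * collisions (suc M)               ≤⟨ *-monoʳ-≤ (2 * k) (collisions-suc M) ⟩
    2 * k * (k * collisions M + M * k ^ M)  ≡⟨ expand k (collisions M) M (k ^ M) ⟩
    k * (2 * k * collisions M) + 2 * M * k ^ suc M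
                                            ≤⟨ +-monoˡ-≤ _ (*-monoʳ-≤ k (birthday-bound M)) ⟩
    k * (M * M * k ^ M) + 2 * M * k ^ suc M ≡⟨ collect k M (k ^ M) ⟩
    (M * M + 2 * M) * k ^ suc M             ≤⟨ *-monoˡ-≤ _ (m≤m+n (M * M + 2 * M) 1) ⟩
    (M * M + 2 * M + 1) * k ^ suc M         ≡⟨ cong (_* k ^ suc M) (square-suc M) ⟩
    suc M * suc M * k ^ suc M               ∎
    where
    open ≤-Reasoning
    expand : ∀ k c M p → 2 * k * (k * c + M * p) ≡ k * (2 * k * c) + 2 * M * (k * p)
    expand = solve-∀
    collect : ∀ k M p → k * (M * M * p) + 2 * M * (k * p) ≡ (M * M + 2 * M) * (k * p)
    collect = solve-∀
    square-suc : ∀ M → M * M + 2 * M + 1 ≡ suc M * suc M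
    square-suc = solve-∀

^-cancelʳ-≤ : ∀ n .{{_ : NonZero n}} {a b} → a ^ n ≤ b ^ n → a ≤ b
^-cancelʳ-≤ n {a} {b} aⁿ≤bⁿ with a ≤? b
... | yes a≤b = a≤b
... | no a≰b = ⊥-elim (<⇒≱ (^-monoˡ-< n (≰⇒> a≰b)) aⁿ≤bⁿ)

m≤m^[1+n] : ∀ m n .{{_ : NonZero m}} → m ≤ m ^ suc n
m≤m^[1+n] m n = m≤m*n m (m ^ n) {{m^n≢0 m n}}

2x≤16x⁴ : ∀ x → 1 ≤ x → 2 * x ≤ 16 * x ^ 4
2x≤16x⁴ x 1≤x = ≤-trans (*-monoʳ-≤ 2 (m≤m^[1+n] x 3 {{>-nonZero 1≤x}})) (*-monoˡ-≤ (x ^ 4) {2} {16} (s≤s (s≤s z≤n)))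

-- For k ≥ 16 x⁴ the overload threshold (M/k)(1 + k^{3/4}) is at most 2M/k^{1/4} ≤ M/x.
¬exceeds⇒small : ∀ M k x l → 1 ≤ x → 16 * x ^ 4 ≤ k → ¬ T (exceedsᵇ M k l) → l * x ≤ M
¬exceeds⇒small M k x l 1≤x 16x⁴≤k ¬exceeds with M <ᵇ l * k in overM
... | false = begin
  l * x ≤⟨ *-monoʳ-≤ l (≤-trans (m≤m+n x (x + 0)) 2x≤k) ⟩
  l * k ≤⟨ ≮⇒≥ (λ M<lk → subst T overM (<⇒<ᵇ M<lk)) ⟩
  M     ∎
  where
  open ≤-Reasoning
  2x≤k = ≤-trans (2x≤16x⁴ x 1≤x) 16x⁴≤k
... | true = *-cancelʳ-≤ (l * x) M k {{k≢0}} (*-cancelˡ-≤ 2 (begin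
  2 * (l * x * k)     ≡⟨ regroup l x k ⟩
  2 * x * (l * k)     ≡⟨ cong (2 * x *_) (m∸n+n≡m (<⇒≤ M<lk)) ⟨
  2 * x * (t + M)     ≡⟨ *-distribˡ-+ (2 * x) t M ⟩
  2 * x * t + 2 * x * M ≤⟨ +-mono-≤ 2xt≤Mk (≤-trans (≤-reflexive (*-comm (2 * x) M)) (*-monoʳ-≤ M 2x≤k)) ⟩
  M * k + M * k       ≡⟨ cong (M * k +_) (+-identityʳ (M * k)) ⟨
  2 * (M * k)         ∎))
  where
  open ≤-Reasoning
  2x≤k = ≤-trans (2x≤16x⁴ x 1≤x) 16x⁴≤k
  k≢0 : NonZero k
  k≢0 = >-nonZero (≤-trans 1≤x (≤-trans (m≤m+n x (x + 0)) 2x≤k))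
  M<lk : M < l * k
  M<lk = <ᵇ⇒< M (l * k) (subst T (sym overM) _)
  t = l * k ∸ M
  t⁴≤M⁴k³ : t ^ 4 ≤ M ^ 4 * k ^ 3
  t⁴≤M⁴k³ = ≮⇒≥ (¬exceeds ∘ <⇒<ᵇ)
  2xt≤Mk : 2 * x * t ≤ M * k
  2xt≤Mk = ^-cancelʳ-≤ 4 (begin
    (2 * x * t) ^ 4       ≡⟨ fourth-power x t ⟩
    16 * x ^ 4 * t ^ 4    ≤⟨ *-mono-≤ 16x⁴≤k t⁴≤M⁴k³ ⟩
    k * (M ^ 4 * k ^ 3)   ≡⟨ gather k M ⟩
    (M * k) ^ 4           ∎)
    where
    open +-*-Solver
    fourth-power : ∀ a b → (2 * a * b) ^ 4 ≡ 16 * a ^ 4 * b ^ 4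
    fourth-power = solve 2 (λ a b → (con 2 :* a :* b) :^ 4 := con 16 :* a :^ 4 :* b :^ 4) refl
    gather : ∀ k M → k * (M ^ 4 * k ^ 3) ≡ (M * k) ^ 4
    gather = solve 2 (λ k M → k :* (M :^ 4 :* k :^ 3) := (M :* k) :^ 4) refl
  regroup : ∀ l x k → 2 * (l * x * k) ≡ 2 * x * (l * k)
  regroup = solve-∀

uM²≤k : ∀ u M k → u ^ 3 ≤ k → 8 * M ^ 3 ≤ k → u * (M * M) ≤ k
uM²≤k u M k u³≤k 8M³≤k = ^-cancelʳ-≤ 3 (begin
  (u * (M * M)) ^ 3                 ≤⟨ m≤n*m _ 64 ⟩
  64 * (u * (M * M)) ^ 3            ≡⟨ regroup u M ⟩
  u ^ 3 * (8 * M ^ 3 * (8 * M ^ 3)) ≤⟨ *-mono-≤ u³≤k (*-mono-≤ 8M³≤k 8M³≤k) ⟩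
  k * (k * k)                       ≡⟨ cube k ⟩
  k ^ 3                             ∎)
  where
  open ≤-Reasoning
  open +-*-Solver
  regroup : ∀ u M → 64 * (u * (M * M)) ^ 3 ≡ u ^ 3 * (8 * M ^ 3 * (8 * M ^ 3))
  regroup = solve 2 (λ u M → con 64 :* (u :* (M :* M)) :^ 3 := u :^ 3 :* (con 8 :* M :^ 3 :* (con 8 :* M :^ 3))) refl
  cube : ∀ k → k * (k * k) ≡ k ^ 3
  cube = solve 1 (λ k → k :* (k :* k) := k :^ 3) refl

m+n≡o∧2n≤o⇒o≤2m : ∀ m n {o} → m + n ≡ o → 2 * n ≤ o → o ≤ 2 * m
m+n≡o∧2n≤o⇒o≤2m m n refl 2n≤m+n = +-monoʳ-≤ m (≤-trans n≤m (m≤m+n m 0))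
  where
  n≤m : n ≤ m
  n≤m = +-cancelʳ-≤ n n m (subst (_≤ m + n) (cong (n +_) (+-identityʳ n)) 2n≤m+n)

Small : (m x v : ℕ) → Set
Small m x v = v ≤ 1 ⊎ v * x ≤ m

Small-mono : ∀ {M m x v} → M ≤ m → Small M x v → Small m x v
Small-mono M≤m (inj₁ v≤1) = inj₁ v≤1
Small-mono M≤m (inj₂ vx≤M) = inj₂ (≤-trans vx≤M M≤m)

Small-⊔ : ∀ {m x a b} → Small m x a → Small m x b → Small m x (a ⊔ b)
Small-⊔ {a = a} {b} sa sb with ⊔-sel a b
... | inj₁ a⊔b≡a = subst (Small _ _) (sym a⊔b≡a) sa
... | inj₂ a⊔b≡b = subst (Small _ _) (sym a⊔b≡b) sb

Small⇒T : ∀ {m x} v → Small m x v → T ((v ≡ᵇ 1) ∨ (v * x ≤ᵇ m))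
Small⇒T zero _ = _
Small⇒T (suc zero) _ = _
Small⇒T (suc (suc v)) (inj₁ (s≤s ()))
Small⇒T (suc (suc v)) (inj₂ vx≤m) = ≤⇒≤ᵇ vx≤m

allSmall⇒success : ∀ {n u k} m x (pos : Fin n → Fin u) (ω : Fin n → Fin k) →
  (∀ i d → Small m x (newMult pos ω i d)) → T (successᵇ m x pos ω)
allSmall⇒success m x pos ω small = Small⇒T (maxNewMult pos ω)
  (foldr-preservesᵇ {P = Small m x} Small-⊔ (inj₁ z≤n)
    (concat⁺ (map⁺ (tabulate⁺ λ i → map⁺ (tabulate⁺ (small i))))))

record RareEvent (k u x M : ℕ) : Set where
  field
    bad        : (Fin k → ℕ) → Bool
    bad-cong   : ∀ {l l′} → (∀ d → l d ≡ l′ d) → bad l ≡ bad l′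
    ¬bad⇒Small : ∀ l → ¬ T (bad l) → ∀ d → Small M x (l d)
    rare       : 2 * u * sumFuns M k (λ ω → ⟦ bad (loadOn (λ _ → true) ω) ⟧) ≤ k ^ M

overloadEvent : ∀ {k u x M} → 1 ≤ x → 16 * x ^ 4 ≤ k → u ≤ k →
  2 * k * countB overloadedᵇ (funs M k) ≤ k ^ M → RareEvent k u x M
overloadEvent {k} {u} {x} {M} 1≤x 16x⁴≤k u≤k rarely-overloaded = record
  { bad        = overloaded
  ; bad-cong   = λ l≗l′ → any-allFin-cong (cong (exceedsᵇ M k) ∘ l≗l′)
  ; ¬bad⇒Small = λ l ¬bad d →
      inj₂ (¬exceeds⇒small M k x (l d) 1≤x 16x⁴≤k (¬any-allFin _ ¬bad d))
  ; rare       = begin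
      2 * u * sumFuns M k (λ ω → ⟦ overloaded (loadOn (λ _ → true) ω) ⟧)
        ≤⟨ *-monoˡ-≤ _ (*-monoʳ-≤ 2 u≤k) ⟩
      2 * k * sumFuns M k (λ ω → ⟦ overloaded (loadOn (λ _ → true) ω) ⟧)
        ≡⟨ cong (2 * k *_) (sumFuns-cong M λ ω →
             cong ⟦_⟧ (any-allFin-cong λ d → cong (exceedsᵇ M k) (load≡loadOn ω d))) ⟨
      2 * k * sumFuns M k (⟦_⟧ ∘ overloadedᵇ)
        ≡⟨ cong (2 * k *_) (countB-funs M k overloadedᵇ) ⟨
      2 * k * countB overloadedᵇ (funs M k)
        ≤⟨ rarely-overloaded ⟩
      k ^ M ∎
  }
  where
  open ≤-Reasoning
  overloaded : (Fin k → ℕ) → Bool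
  overloaded l = any (λ d → exceedsᵇ M k (l d)) (allFin k)

collisionEvent : ∀ {k u x M} → 1 ≤ k → u * (M * M) ≤ k → RareEvent k u x M
collisionEvent {k} {u} {x} {M} 1≤k uM²≤k = record
  { bad        = collides
  ; bad-cong   = collides-cong
  ; ¬bad⇒Small = λ l ¬bad d → inj₁ (¬collides⇒≤1 l ¬bad d)
  ; rare       = *-cancelˡ-≤ k {{>-nonZero 1≤k}} (begin
      k * (2 * u * collisions M)  ≡⟨ regroup k u (collisions M) ⟩
      u * (2 * k * collisions M)  ≤⟨ *-monoʳ-≤ u (birthday-bound M) ⟩
      u * (M * M * k ^ M)         ≡⟨ *-assoc u (M * M) (k ^ M) ⟨
      u * (M * M) * k ^ M         ≤⟨ *-monoˡ-≤ (k ^ M) uM²≤k ⟩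
      k * k ^ M                   ∎)
  }
  where
  open ≤-Reasoning
  regroup : ∀ k u c → k * (2 * u * c) ≡ u * (2 * k * c)
  regroup = solve-∀

16x⁴≤kOf : ∀ x u N → 16 * x ^ 4 ≤ kOf x u N
16x⁴≤kOf x u N = ≤-trans (m≤m⊔n _ (u ^ 3)) (m≤m⊔n _ (8 * N ^ 3))

u³≤kOf : ∀ x u N → u ^ 3 ≤ kOf x u N
u³≤kOf x u N = ≤-trans (m≤n⊔m (16 * x ^ 4) _) (m≤m⊔n _ (8 * N ^ 3))

8N³≤kOf : ∀ x u N → 8 * N ^ 3 ≤ kOf x u N
8N³≤kOf x u N = m≤n⊔m _ _

module Scattering (N : ℕ) (goodN : GoodN N) (u x : ℕ) (1≤u : 1 ≤ u) (1≤x : 1 ≤ x) where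

  k : ℕ
  k = kOf x u N

  1≤k : 1 ≤ k
  1≤k = ≤-trans 1≤x (≤-trans (m≤m+n x (x + 0)) (≤-trans (2x≤16x⁴ x 1≤x) (16x⁴≤kOf x u N)))

  -- The hypothesis on 𝒩 covers N < M with k ≤ 8M³; in every other case u M² ≤ k.
  rareEvent : ∀ M → RareEvent k u x M
  rareEvent M with N <? M | k ≤? 8 * M ^ 3
  ... | yes N<M | yes k≤8M³ = overloadEvent 1≤x (16x⁴≤kOf x u N) u≤k (goodN M k N<M 1≤k k≤8M³)
    where
    u≤k = ≤-trans (m≤m^[1+n] u 2 {{>-nonZero 1≤u}}) (u³≤kOf x u N)
  ... | yes _ | no k≰8M³ = collisionEvent 1≤k (uM²≤k u M k (u³≤kOf x u N) (<⇒≤ (≰⇒> k≰8M³)))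
  ... | no N≮M | _ = collisionEvent 1≤k (uM²≤k u M k (u³≤kOf x u N)
                       (≤-trans (*-monoʳ-≤ 8 (^-monoˡ-≤ 3 (≮⇒≥ N≮M))) (8N³≤kOf x u N)))

  module _ {n} (pos : Fin n → Fin u) where

    atPoint : Fin u → Fin n → Bool
    atPoint i j = pos j =ᶠ i

    badAt : Fin u → (Fin n → Fin k) → Bool
    badAt i ω = RareEvent.bad (rareEvent (count (atPoint i))) (loadOn (atPoint i) ω)

    badAt-rare : ∀ i → 2 * u * sumFuns n k (⟦_⟧ ∘ badAt i) ≤ k ^ n
    badAt-rare i = begin
      2 * u * sumFuns n k (⟦_⟧ ∘ badAt i)     ≡⟨ cong (2 * u *_) (sumFuns-marginal (atPoint i) (λ _ → 0)) ⟩
      2 * u * (k ^ f * sumFuns M k badLoad)  ≡⟨ regroup (2 * u) (k ^ f) _ ⟩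
      k ^ f * (2 * u * sumFuns M k badLoad)  ≤⟨ *-monoʳ-≤ (k ^ f) (RareEvent.rare E) ⟩
      k ^ f * k ^ M                          ≡⟨ ^-distribˡ-+-* k f M ⟨
      k ^ (f + M)                            ≡⟨ cong (k ^_) (trans (+-comm f M) (count+count-not (atPoint i))) ⟩
      k ^ n                                  ∎
      where
      open ≤-Reasoning
      M = count (atPoint i)
      f = count (not ∘ atPoint i)
      E = rareEvent M
      open Marginal (⟦_⟧ ∘ RareEvent.bad E) (cong ⟦_⟧ ∘ RareEvent.bad-cong E)
      badLoad : (Fin M → Fin k) → ℕ
      badLoad ω = ⟦ RareEvent.bad E (loadOn (λ _ → true) ω) ⟧
      regroup : ∀ a b c → a * (b * c) ≡ b * (a * c)
      regroup = solve-∀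

    module _ (m : ℕ) (mult≤m : ∀ i → mult pos i ≤ m) where

      failure≤countBad : ∀ ω → ⟦ not (successᵇ m x pos ω) ⟧ ≤ count (λ i → badAt i ω)
      failure≤countBad ω = ⟦⟧≤count _ _ λ noBad → T⇒¬T-not (allSmall⇒success m x pos ω λ i d →
        subst (Small m x) (sym (newMult≡loadOn pos ω i d))
          (Small-mono (count≤m i) (RareEvent.¬bad⇒Small (rareEvent _) _ (noBad i) d)))
        where
        T⇒¬T-not : ∀ {b} → T b → ¬ T (not b)
        T⇒¬T-not {true} _ ()
        count≤m : ∀ i → count (atPoint i) ≤ m
        count≤m i = subst (_≤ m) (countB-allFin (atPoint i)) (mult≤m i)

      successes failures : ℕ
      successes = sumFuns n k (λ ω → ⟦ successᵇ m x pos ω ⟧)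
      failures = sumFuns n k (λ ω → ⟦ not (successᵇ m x pos ω) ⟧)

      successes+failures : successes + failures ≡ k ^ n
      successes+failures = begin
        successes + failures ≡⟨ sumFuns-distrib-+ n _ _ ⟨
        sumFuns n k (λ ω → ⟦ successᵇ m x pos ω ⟧ + ⟦ not (successᵇ m x pos ω) ⟧)
          ≡⟨ sumFuns-cong n (λ ω → ⟦b⟧+⟦not-b⟧≡1 (successᵇ m x pos ω)) ⟩
        sumFuns n k (λ _ → 1) ≡⟨ sumFuns-const n 1 ⟩
        1 * k ^ n             ≡⟨ *-identityˡ (k ^ n) ⟩
        k ^ n                 ∎
        where open ≡-Reasoning

      2*failures≤kⁿ : 2 * failures ≤ k ^ n
      2*failures≤kⁿ = *-cancelˡ-≤ u {{>-nonZero 1≤u}} (begin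
        u * (2 * failures)
          ≡⟨ regroup u failures ⟩
        2 * u * failures
          ≤⟨ *-monoʳ-≤ (2 * u) (sumFuns-mono-≤ n failure≤countBad) ⟩
        2 * u * sumFuns n k (λ ω → count (λ i → badAt i ω))
          ≡⟨ cong (2 * u *_) (sumFuns-comm n λ i ω → ⟦ badAt i ω ⟧) ⟩
        2 * u * ∑[ i < u ] sumFuns n k (⟦_⟧ ∘ badAt i)
          ≡⟨ *-distribˡ-sum (2 * u) (λ i → sumFuns n k (⟦_⟧ ∘ badAt i)) ⟩
        ∑[ i < u ] (2 * u * sumFuns n k (⟦_⟧ ∘ badAt i))
          ≤⟨ sum-mono-≤ badAt-rare ⟩
        ∑[ i < u ] (k ^ n) ≡⟨ sum-const u (k ^ n) ⟩
        u * k ^ n ∎)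
        where
        open ≤-Reasoning
        regroup : ∀ u f → u * (2 * f) ≡ 2 * u * f
        regroup = solve-∀

      success-bound : k ^ n ≤ 2 * countB (successᵇ m x pos) (funs n k)
      success-bound = begin
        k ^ n                  ≤⟨ m+n≡o∧2n≤o⇒o≤2m successes failures successes+failures 2*failures≤kⁿ ⟩
        2 * successes          ≡⟨ cong (2 *_) (countB-funs n k (successᵇ m x pos)) ⟨
        2 * countB (successᵇ m x pos) (funs n k) ∎
        where open ≤-Reasoning

lemma8 : (N : ℕ) → GoodN N →
    (n u m x : ℕ) → 1 ≤ u → 1 ≤ x →
    (pos : Fin n → Fin u) →
    (∀ (i : Fin u) → ∃ λ (j : Fin n) → pos j ≡ i) →
    (∀ (i : Fin u) → mult pos i ≤ m) →
    (kOf x u N) ^ n ≤ 2 * countB (successᵇ m x pos) (funs n (kOf x u N))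
lemma8 N goodN n u m x 1≤u 1≤x pos _ mult≤m = Scattering.success-bound N goodN u x 1≤u 1≤x pos m mult≤m
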